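{- Let $m\ge2$, let $A$ be a set of integers with $1<\min(A)\le\max(A)<m$, let $\mathbf{m}=(k_1,\dots,k_m)$ with $k_i\ge0$, and let $w\in\mathfrak{S}_{\mathbf m}$ contain at least one letter from $A$. Then $\mathrm{Last}_{A-1}\big(\theta_{(m-2)!}(w)\big)=\mathrm{Last}_{A}(w)-1$.
   Context: $\mathfrak{S}_{\mathbf m}$ is the set of words with exactly $k_i$ copies of $i$. $S-1=\{s-1:s\in S\}$. For a word $u$ containing some letter of a set $B$, $\mathrm{Last}_B(u)$ is the rightmost letter of $u$ belonging to $B$. For $1\le i\le m-1$, $\theta_i$ acts on a word as follows: replace every factor $(i+1)i$ by a special symbol $\sim$; in the resulting word each maximal factor consisting only of letters $i$ and $i+1$ has the form $i^a(i+1)^b$ ($a,b\ge0$), and it is replaced by $i^b(i+1)^a$; then each $\sim$ is replaced back by $(i+1)i$. $\theta_0=\mathrm{id}$ and $\theta_{j!}=\theta_j\circ\cdots\circ\theta_1\circ\theta_0$. -}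

module Defs where

open import Data.Nat using (ℕ; zero; suc; _+_; _∸_; _≡ᵇ_; _≤_)
open import Data.Bool using (Bool; true; false; if_then_else_)
open import Data.List using (List; []; _∷_; _++_; replicate)
open import Data.Maybe using (Maybe; just; nothing)
open import Data.Fin using (Fin; toℕ)
open import Data.Product using (_×_)
open import Data.List.Relation.Unary.All using (All)
open import Relation.Binary.PropositionalEquality using (_≡_)

Word : Set
Word = List ℕ

occ : ℕ → Word → ℕ
occ x [] = 0
occ x (y ∷ u) = if x ≡ᵇ y then suc (occ x u) else occ x u

-- w ∈ 𝔖_m  where  m = (k_1,…,k_m) is given by k : Fin m → ℕ (k i = k_{i+1}):
-- every letter lies in {1,…,m} and letter j occurs exactly k_j times.
InS : (m : ℕ) → (Fin m → ℕ) → Word → Set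
InS m k w = All (λ x → 1 ≤ x × x ≤ m) w × (∀ (i : Fin m) → occ (suc (toℕ i)) w ≡ k i)

LetterSet : Set
LetterSet = ℕ → Bool

-- S - 1 = { s - 1 : s ∈ S }   (for S ⊆ ℕ≥1:  x ∈ S-1 ⟺ x+1 ∈ S)
shift : LetterSet → LetterSet
shift S x = S (suc x)

lastIn : LetterSet → Word → Maybe ℕ
lastIn B [] = nothing
lastIn B (x ∷ u) with lastIn B u
... | just y = just y
... | nothing = if B x then just x else nothing

-- θ_i.  Step 1: replace every factor (i+1) i by the symbol ∼.
data Tok : Set where
  tilde  : Tok
  letter : ℕ → Tok

tokenize : ℕ → Word → List Tok
tokenize i [] = []
tokenize i (x ∷ []) = letter x ∷ []
tokenize i (x ∷ y ∷ u) =
  if (x ≡ᵇ suc i) Data.Bool.∧ (y ≡ᵇ i)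
  then tilde ∷ tokenize i u
  else letter x ∷ tokenize i (y ∷ u)

-- Step 2: each maximal factor of letters i, i+1 (which has the form i^a (i+1)^b)
-- is replaced by i^b (i+1)^a; step 3: each ∼ is replaced back by (i+1) i.
-- 'a' and 'b' accumulate the numbers of i's and (i+1)'s in the current block.
flush : ℕ → ℕ → ℕ → Word
flush i a b = replicate b i ++ replicate a (suc i)

rebuild : ℕ → ℕ → ℕ → List Tok → Word
rebuild i a b [] = flush i a b
rebuild i a b (tilde ∷ ts) = flush i a b ++ (suc i ∷ i ∷ rebuild i 0 0 ts)
rebuild i a b (letter x ∷ ts) =
  if x ≡ᵇ i then rebuild i (suc a) b ts
  else if x ≡ᵇ suc i then rebuild i a (suc b) ts
  else flush i a b ++ (x ∷ rebuild i 0 0 ts)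

θ : ℕ → Word → Word
θ zero w = w
θ (suc j) w = rebuild (suc j) 0 0 (tokenize (suc j) w)

θ! : ℕ → Word → Word
θ! zero w = w
θ! (suc j) w = θ (suc j) (θ! j w)

-- θ_i only rearranges the letters i and i+1 inside each maximal block over {i, i+1}, and it does
-- so in such a way that deleting every i+1 from θ_i(u) gives the word obtained from u by deleting
-- every i and renaming i+1 to i: a block i^a (i+1)^b leaves i^b on both sides, a factor (i+1) i
-- leaves a single i.  Hence, for letter sets B avoiding i and B′ avoiding i+1 that correspond under
-- this renaming, Last_{B′}(θ_i u) is the renamed Last_B(u).  Applying this for i = 1, …, m−2,
-- the set A is lowered one letter at a time, ending at A − 1, and Last_A(w) ends at Last_A(w) − 1.

module Submission where

open import Defs
open import Data.Bool using (true; false; not; _∧_; if_then_else_; T; T?)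
open import Data.Bool.Properties using (T-≡)
open import Data.Empty using (⊥-elim)
open import Data.Fin using (Fin)
open import Data.List using (List; []; _∷_; _++_; replicate; filterᵇ) renaming (map to mapᴸ)
open import Data.List.Properties using (filter-++; ++-identityʳ)
open import Data.List.Relation.Unary.Any using (Any; here; there)
open import Data.Maybe using (just; nothing; map)
open import Data.Maybe.Properties using (map-∘; map-cong; map-id-local)
import Data.Maybe.Relation.Unary.All as Maybe
open import Data.Nat using (ℕ; zero; suc; _∸_; _≤_; _<_; _≡ᵇ_; _≤ᵇ_; _≤?_; _≟_; z≤n; s≤s)
open import Data.Nat.Properties
  using (≡ᵇ⇒≡; ≡⇒≡ᵇ; <-cmp; ≤-pred; ≤-refl; <-irrefl; ≤-<-trans; <-trans; m∸n≤m; n<1+n; 1+n≢n;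
         <⇒≢; >⇒≢; <⇒≱; ≤∧≢⇒<; <⇒≤)
open import Data.Product using (Σ; _×_; ∃-syntax; _,_; proj₁; proj₂)
open import Function using (_∘_; Equivalence)
open import Relation.Binary using (tri<; tri≈; tri>)
open import Relation.Binary.PropositionalEquality
  using (_≡_; _≢_; refl; sym; trans; subst; cong; cong₂; module ≡-Reasoning)
open import Relation.Nullary using (¬_; yes; no)
open import Relation.Nullary.Decidable using (dec-true; dec-false)
open ≡-Reasoning

≡ᵇ-refl : ∀ n → (n ≡ᵇ n) ≡ true
≡ᵇ-refl n = dec-true (n ≟ n) refl

≢⇒≡ᵇ-false : ∀ {m n} → m ≢ n → (m ≡ᵇ n) ≡ false
≢⇒≡ᵇ-false {m} {n} = dec-false (m ≟ n)

≡ᵇ-true⇒≡ : ∀ {m n} → (m ≡ᵇ n) ≡ true → m ≡ n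
≡ᵇ-true⇒≡ {m} {n} eq = ≡ᵇ⇒≡ m n (Equivalence.from T-≡ eq)

≡ᵇ-false⇒≢ : ∀ {m n} → (m ≡ᵇ n) ≡ false → m ≢ n
≡ᵇ-false⇒≢ {m} {n} eq m≡n = subst T eq (≡⇒≡ᵇ m n m≡n)

≤ᵇ-true : ∀ {m n} → m ≤ n → (m ≤ᵇ n) ≡ true
≤ᵇ-true {m} {n} = dec-true (m ≤? n)

≤ᵇ-false : ∀ {m n} → n < m → (m ≤ᵇ n) ≡ false
≤ᵇ-false {m} {n} n<m = dec-false (m ≤? n) (<⇒≱ n<m)

excluded⇒false : ∀ {A : LetterSet} {P : ℕ → Set} → (∀ a → T (A a) → P a) → ∀ a → ¬ P a → A a ≡ false
excluded⇒false {A} A⊆P a ¬Pa with A a in Aa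
... | true = ⊥-elim (¬Pa (A⊆P a (Equivalence.from T-≡ Aa)))
... | false = refl

lastIn-cong : ∀ {B C : LetterSet} → (∀ x → B x ≡ C x) → ∀ u → lastIn B u ≡ lastIn C u
lastIn-cong B≗C [] = refl
lastIn-cong {C = C} B≗C (x ∷ u) rewrite lastIn-cong B≗C u with lastIn C u
... | just y = refl
... | nothing rewrite B≗C x = refl

lastIn-filterᵇ : ∀ (B p : LetterSet) u → lastIn B (filterᵇ p u) ≡ lastIn (λ x → p x ∧ B x) u
lastIn-filterᵇ B p [] = refl
lastIn-filterᵇ B p (x ∷ u) with p x in px
... | true rewrite lastIn-filterᵇ B p u with lastIn (λ y → p y ∧ B y) u
...   | just y = refl
...   | nothing rewrite px = refl
lastIn-filterᵇ B p (x ∷ u) | false rewrite lastIn-filterᵇ B p u with lastIn (λ y → p y ∧ B y) u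
...   | just y = refl
...   | nothing rewrite px = refl

lastIn-map : ∀ (B : LetterSet) (g : ℕ → ℕ) u → lastIn B (mapᴸ g u) ≡ map g (lastIn (B ∘ g) u)
lastIn-map B g [] = refl
lastIn-map B g (x ∷ u) rewrite lastIn-map B g u with lastIn (B ∘ g) u
... | just y = refl
... | nothing with B (g x)
...   | true = refl
...   | false = refl

lastIn-sound : ∀ (B : LetterSet) u → Maybe.All (T ∘ B) (lastIn B u)
lastIn-sound B [] = Maybe.nothing
lastIn-sound B (x ∷ u) with lastIn B u | lastIn-sound B u
... | just y | By = By
... | nothing | _ with B x in Bx
...   | true = Maybe.just (Equivalence.from T-≡ Bx)
...   | false = Maybe.nothing

lastIn-found : ∀ (B : LetterSet) u → Any (T ∘ B) u → ∃[ a ] (lastIn B u ≡ just a × T (B a))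
lastIn-found B (x ∷ u) (there Bu) with lastIn B u | lastIn-found B u Bu
... | .(just a) | a , refl , Ba = a , refl , Ba
lastIn-found B (x ∷ u) (here Bx) with lastIn B u | lastIn-sound B u
... | just y | Maybe.just By = y , refl , By
... | nothing | _ with B x in Bx≡
...   | true = x , refl , Equivalence.from T-≡ Bx≡
...   | false = ⊥-elim Bx

erase : ℕ → Word → Word
erase c = filterᵇ (λ x → not (x ≡ᵇ c))

lastIn-erase : ∀ c {B C : LetterSet} → B c ≡ false → (∀ x → x ≢ c → C x ≡ B x) →
               ∀ u → lastIn C (erase c u) ≡ lastIn B u
lastIn-erase c {B} {C} Bc≡false C≗B u = trans (lastIn-filterᵇ C _ u) (lastIn-cong agree u)
  where
  agree : ∀ x → not (x ≡ᵇ c) ∧ C x ≡ B x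
  agree x with x ≡ᵇ c in x≟c
  ... | true with refl ← ≡ᵇ-true⇒≡ {x} {c} x≟c = sym Bc≡false
  ... | false = C≗B x (≡ᵇ-false⇒≢ {x} {c} x≟c)

erase-++ : ∀ c u v → erase c (u ++ v) ≡ erase c u ++ erase c v
erase-++ c = filter-++ (λ x → T? (not (x ≡ᵇ c)))

erase-∷-other : ∀ {c x} u → x ≢ c → erase c (x ∷ u) ≡ x ∷ erase c u
erase-∷-other u x≢c rewrite ≢⇒≡ᵇ-false x≢c = refl

erase-replicate-self : ∀ c n → erase c (replicate n c) ≡ []
erase-replicate-self c zero = refl
erase-replicate-self c (suc n) rewrite ≡ᵇ-refl c = erase-replicate-self c n

erase-replicate-other : ∀ {c x} n → x ≢ c → erase c (replicate n x) ≡ replicate n x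
erase-replicate-other zero _ = refl
erase-replicate-other (suc n) x≢c rewrite ≢⇒≡ᵇ-false x≢c = cong (_ ∷_) (erase-replicate-other n x≢c)

lower : ℕ → ℕ → ℕ
lower i x = if x ≡ᵇ suc i then i else x

lower-suc : ∀ i → lower i (suc i) ≡ i
lower-suc i rewrite ≡ᵇ-refl i = refl

lower-≢ : ∀ {i x} → x ≢ suc i → lower i x ≡ x
lower-≢ x≢1+i rewrite ≢⇒≡ᵇ-false x≢1+i = refl

detokenize : ℕ → List Tok → Word
detokenize i [] = []
detokenize i (tilde ∷ ts) = suc i ∷ i ∷ detokenize i ts
detokenize i (letter x ∷ ts) = x ∷ detokenize i ts

detokenize-tokenize : ∀ i u → detokenize i (tokenize i u) ≡ u
detokenize-tokenize i [] = refl
detokenize-tokenize i (x ∷ []) = refl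
detokenize-tokenize i (x ∷ y ∷ u)
  with ih ← detokenize-tokenize i (y ∷ u) | x ≡ᵇ suc i in x≟ | y ≡ᵇ i in y≟
... | true | true with refl ← ≡ᵇ-true⇒≡ {x} x≟ | refl ← ≡ᵇ-true⇒≡ {y} y≟ =
  cong (λ v → suc i ∷ i ∷ v) (detokenize-tokenize i u)
... | true | false = cong (x ∷_) ih
... | false | _ = cong (x ∷_) ih

replicate-suc-++ : ∀ {A : Set} n (x : A) ys → replicate (suc n) x ++ ys ≡ replicate n x ++ x ∷ ys
replicate-suc-++ zero x ys = refl
replicate-suc-++ (suc n) x ys = cong (x ∷_) (replicate-suc-++ n x ys)

erase-flush : ∀ i a b → erase (suc i) (flush i a b) ≡ replicate b i
erase-flush i a b = begin
  erase (suc i) (replicate b i ++ replicate a (suc i))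
    ≡⟨ erase-++ (suc i) (replicate b i) _ ⟩
  erase (suc i) (replicate b i) ++ erase (suc i) (replicate a (suc i))
    ≡⟨ cong₂ _++_ (erase-replicate-other b (1+n≢n ∘ sym)) (erase-replicate-self (suc i) a) ⟩
  replicate b i ++ []
    ≡⟨ ++-identityʳ _ ⟩
  replicate b i ∎

-- rebuild i a b ts is the image under θ_i of i^a (i+1)^b followed by detokenize i ts.
erase-rebuild : ∀ i a b ts →
  erase (suc i) (rebuild i a b ts) ≡ replicate b i ++ mapᴸ (lower i) (erase i (detokenize i ts))
erase-rebuild i a b [] = trans (erase-flush i a b) (sym (++-identityʳ _))
erase-rebuild i a b (tilde ∷ ts) = begin
  erase (suc i) (flush i a b ++ suc i ∷ i ∷ rebuild i 0 0 ts)
    ≡⟨ erase-++ (suc i) (flush i a b) _ ⟩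
  erase (suc i) (flush i a b) ++ erase (suc i) (suc i ∷ i ∷ rebuild i 0 0 ts)
    ≡⟨ cong₂ _++_ (erase-flush i a b) erase-tilde ⟩
  replicate b i ++ i ∷ erase (suc i) (rebuild i 0 0 ts)
    ≡⟨ cong (λ v → replicate b i ++ i ∷ v) (erase-rebuild i 0 0 ts) ⟩
  replicate b i ++ i ∷ mapᴸ (lower i) (erase i (detokenize i ts))
    ≡⟨ cong (replicate b i ++_) lower-erase-tilde ⟨
  replicate b i ++ mapᴸ (lower i) (erase i (suc i ∷ i ∷ detokenize i ts)) ∎
  where
  erase-tilde : erase (suc i) (suc i ∷ i ∷ rebuild i 0 0 ts) ≡ i ∷ erase (suc i) (rebuild i 0 0 ts)
  erase-tilde rewrite ≡ᵇ-refl i | ≢⇒≡ᵇ-false (1+n≢n {i} ∘ sym) = refl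
  lower-erase-tilde : mapᴸ (lower i) (erase i (suc i ∷ i ∷ detokenize i ts)) ≡
                      i ∷ mapᴸ (lower i) (erase i (detokenize i ts))
  lower-erase-tilde rewrite ≢⇒≡ᵇ-false (1+n≢n {i}) | ≡ᵇ-refl i = refl
erase-rebuild i a b (letter x ∷ ts) with x ≡ᵇ i in x≟i
... | true = erase-rebuild i (suc a) b ts
... | false with x ≡ᵇ suc i in x≟1+i
...   | true = trans (erase-rebuild i a (suc b) ts) (replicate-suc-++ b i _)
...   | false = begin
  erase (suc i) (flush i a b ++ x ∷ rebuild i 0 0 ts)
    ≡⟨ erase-++ (suc i) (flush i a b) _ ⟩
  erase (suc i) (flush i a b) ++ erase (suc i) (x ∷ rebuild i 0 0 ts)
    ≡⟨ cong₂ _++_ (erase-flush i a b)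
                      (trans (erase-∷-other _ (≡ᵇ-false⇒≢ {x} x≟1+i)) (cong (x ∷_) (erase-rebuild i 0 0 ts))) ⟩
  replicate b i ++ x ∷ mapᴸ (lower i) (erase i (detokenize i ts)) ∎

erase-θ : ∀ i u → erase (suc (suc i)) (θ (suc i) u) ≡ mapᴸ (lower (suc i)) (erase (suc i) u)
erase-θ i u = trans (erase-rebuild (suc i) 0 0 (tokenize (suc i) u))
                    (cong (mapᴸ (lower (suc i)) ∘ erase (suc i)) (detokenize-tokenize (suc i) u))

lastIn-θ : ∀ i {B B′ : LetterSet} → B (suc i) ≡ false → B′ (suc (suc i)) ≡ false →
           (∀ x → x ≢ suc i → B′ (lower (suc i) x) ≡ B x) →
           ∀ u → lastIn B′ (θ (suc i) u) ≡ map (lower (suc i)) (lastIn B u)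
lastIn-θ i {B} {B′} B[1+i]≡false B′[2+i]≡false B′∘lower≗B u = begin
  lastIn B′ (θ (suc i) u)
    ≡⟨ lastIn-erase (suc (suc i)) B′[2+i]≡false (λ _ _ → refl) (θ (suc i) u) ⟨
  lastIn B′ (erase (suc (suc i)) (θ (suc i) u))
    ≡⟨ cong (lastIn B′) (erase-θ i u) ⟩
  lastIn B′ (mapᴸ (lower (suc i)) (erase (suc i) u))
    ≡⟨ lastIn-map B′ (lower (suc i)) (erase (suc i) u) ⟩
  map (lower (suc i)) (lastIn (B′ ∘ lower (suc i)) (erase (suc i) u))
    ≡⟨ cong (map (lower (suc i))) (lastIn-erase (suc i) B[1+i]≡false B′∘lower≗B u) ⟩
  map (lower (suc i)) (lastIn B u) ∎

lowerUpTo : ℕ → ℕ → ℕ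
lowerUpTo j a = if a ≤ᵇ suc j then a ∸ 1 else a

lowerUpTo-≤ : ∀ {j a} → a ≤ suc j → lowerUpTo j a ≡ a ∸ 1
lowerUpTo-≤ a≤1+j rewrite ≤ᵇ-true a≤1+j = refl

lowerUpTo-> : ∀ {j a} → suc j < a → lowerUpTo j a ≡ a
lowerUpTo-> 1+j<a rewrite ≤ᵇ-false 1+j<a = refl

lower∘lowerUpTo : ∀ j a → lower (suc j) (lowerUpTo j a) ≡ lowerUpTo (suc j) a
lower∘lowerUpTo j a with <-cmp a (suc (suc j))
... | tri< a<2+j _ _ rewrite lowerUpTo-≤ (≤-pred a<2+j) | lowerUpTo-≤ (<⇒≤ a<2+j) =
  lower-≢ (<⇒≢ (≤-<-trans (m∸n≤m a 1) a<2+j))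
... | tri≈ _ refl _ rewrite lowerUpTo-> (n<1+n (suc j)) | lowerUpTo-≤ (≤-refl {suc (suc j)}) =
  lower-suc (suc j)
... | tri> _ _ 2+j<a rewrite lowerUpTo-> (<-trans (n<1+n (suc j)) 2+j<a) | lowerUpTo-> 2+j<a =
  lower-≢ (>⇒≢ 2+j<a)

-- For A ⊆ {2, 3, …} this is the image of A under lowerUpTo j.
lowerSetUpTo : ℕ → LetterSet → LetterSet
lowerSetUpTo j A x = if x ≤ᵇ j then A (suc x) else if x ≡ᵇ suc j then false else A x

lowerSetUpTo-≤ : ∀ {j} A {x} → x ≤ j → lowerSetUpTo j A x ≡ A (suc x)
lowerSetUpTo-≤ A x≤j rewrite ≤ᵇ-true x≤j = refl

lowerSetUpTo-suc : ∀ j A → lowerSetUpTo j A (suc j) ≡ false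
lowerSetUpTo-suc j A rewrite ≤ᵇ-false (n<1+n j) | ≡ᵇ-refl j = refl

lowerSetUpTo-> : ∀ {j} A {x} → suc j < x → lowerSetUpTo j A x ≡ A x
lowerSetUpTo-> A 1+j<x rewrite ≤ᵇ-false (<-trans (n<1+n _) 1+j<x) | ≢⇒≡ᵇ-false (>⇒≢ 1+j<x) = refl

lowerSetUpTo-lower : ∀ j A x → x ≢ suc j → lowerSetUpTo (suc j) A (lower (suc j) x) ≡ lowerSetUpTo j A x
lowerSetUpTo-lower j A x x≢1+j with <-cmp x (suc j)
... | tri< x<1+j _ _ rewrite lower-≢ {suc j} (<⇒≢ (<-trans x<1+j (n<1+n _))) =
  trans (lowerSetUpTo-≤ A (<⇒≤ x<1+j)) (sym (lowerSetUpTo-≤ A (≤-pred x<1+j)))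
... | tri≈ _ x≡1+j _ = ⊥-elim (x≢1+j x≡1+j)
... | tri> _ _ 1+j<x with x ≟ suc (suc j)
...   | yes refl rewrite lower-suc (suc j) =
  trans (lowerSetUpTo-≤ A (≤-refl {suc j})) (sym (lowerSetUpTo-> A 1+j<x))
...   | no x≢2+j rewrite lower-≢ x≢2+j =
  trans (lowerSetUpTo-> A (≤∧≢⇒< 1+j<x (x≢2+j ∘ sym))) (sym (lowerSetUpTo-> A 1+j<x))

lowerSetUpTo-zero : ∀ {A : LetterSet} → (∀ a → T (A a) → 1 < a) → ∀ x → lowerSetUpTo 0 A x ≡ A x
lowerSetUpTo-zero A>1 zero = trans (excluded⇒false A>1 1 (<-irrefl refl)) (sym (excluded⇒false A>1 0 λ ()))
lowerSetUpTo-zero A>1 (suc zero) = sym (excluded⇒false A>1 1 (<-irrefl refl))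
lowerSetUpTo-zero A>1 (suc (suc x)) = refl

shift≗lowerSetUpTo : ∀ {A : LetterSet} j → (∀ a → T (A a) → a ≤ suc j) → ∀ x → shift A x ≡ lowerSetUpTo j A x
shift≗lowerSetUpTo {A} j A≤1+j x with <-cmp x (suc j)
... | tri< x<1+j _ _ = sym (lowerSetUpTo-≤ A (≤-pred x<1+j))
... | tri≈ _ refl _ = trans (excluded⇒false A≤1+j _ (<⇒≱ ≤-refl)) (sym (lowerSetUpTo-suc j A))
... | tri> _ _ 1+j<x = begin
  A (suc x)              ≡⟨ excluded⇒false A≤1+j (suc x) (<⇒≱ (<-trans 1+j<x (n<1+n x))) ⟩
  false                  ≡⟨ excluded⇒false A≤1+j x (<⇒≱ 1+j<x) ⟨
  A x                    ≡⟨ lowerSetUpTo-> A 1+j<x ⟨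
  lowerSetUpTo j A x     ∎

lastIn-θ! : ∀ {A : LetterSet} → (∀ a → T (A a) → 1 < a) →
            ∀ j w → lastIn (lowerSetUpTo j A) (θ! j w) ≡ map (lowerUpTo j) (lastIn A w)
lastIn-θ! {A} A>1 zero w = begin
  lastIn (lowerSetUpTo 0 A) w      ≡⟨ lastIn-cong (lowerSetUpTo-zero A>1) w ⟩
  lastIn A w                       ≡⟨ map-id-local (Maybe.map (λ {a} Aa → lowerUpTo-> (A>1 a Aa)) (lastIn-sound A w)) ⟨
  map (lowerUpTo 0) (lastIn A w)   ∎
lastIn-θ! {A} A>1 (suc j) w = begin
  lastIn (lowerSetUpTo (suc j) A) (θ (suc j) (θ! j w))
    ≡⟨ lastIn-θ j (lowerSetUpTo-suc j A) (lowerSetUpTo-suc (suc j) A) (lowerSetUpTo-lower j A) (θ! j w) ⟩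
  map (lower (suc j)) (lastIn (lowerSetUpTo j A) (θ! j w))
    ≡⟨ cong (map (lower (suc j))) (lastIn-θ! A>1 j w) ⟩
  map (lower (suc j)) (map (lowerUpTo j) (lastIn A w))
    ≡⟨ map-∘ (lastIn A w) ⟨
  map (lower (suc j) ∘ lowerUpTo j) (lastIn A w)
    ≡⟨ map-cong (lower∘lowerUpTo j) (lastIn A w) ⟩
  map (lowerUpTo (suc j)) (lastIn A w) ∎

lemma5p4 : (m : ℕ) → 2 ≤ m → (A : LetterSet) →
    (∀ a → T (A a) → 1 < a × a < m) →
    (k : Fin m → ℕ) → (w : Word) → InS m k w →
    Any (λ x → T (A x)) w →
    Σ ℕ (λ x → lastIn A w ≡ just x × lastIn (shift A) (θ! (m ∸ 2) w) ≡ just (x ∸ 1))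
lemma5p4 (suc (suc n)) (s≤s (s≤s z≤n)) A A-range _ w _ A∈w with lastIn-found A w A∈w
... | a , lastA≡a , Aa = a , lastA≡a , (begin
  lastIn (shift A) (θ! n w)            ≡⟨ lastIn-cong (shift≗lowerSetUpTo n A≤1+n) (θ! n w) ⟩
  lastIn (lowerSetUpTo n A) (θ! n w)   ≡⟨ lastIn-θ! A>1 n w ⟩
  map (lowerUpTo n) (lastIn A w)       ≡⟨ cong (map (lowerUpTo n)) lastA≡a ⟩
  just (lowerUpTo n a)                 ≡⟨ cong just (lowerUpTo-≤ (A≤1+n a Aa)) ⟩
  just (a ∸ 1)                         ∎)
  where
  A>1 : ∀ a → T (A a) → 1 < a
  A>1 a Aa = proj₁ (A-range a Aa)
  A≤1+n : ∀ a → T (A a) → a ≤ suc n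
  A≤1+n a Aa = ≤-pred (proj₂ (A-range a Aa))
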